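{- Let $n\ge 2$ and let $S$ be an admissible peak set in $S^B_n$. Then \[\min\{d_H(\sigma,\rho):\sigma,\rho\in P^B(S;n),\ \sigma\ne\rho\}=1,\quad \min\{d_\ell(\sigma,\rho):\sigma,\rho\in P^B(S;n),\ \sigma\ne\rho\}=1,\] \[\min\{d_W(\sigma,\rho):\sigma,\rho\in P^B(S;n),\ \sigma\ne\rho\}=1.\]
   Context: $S^B_n$ is the group (under composition) of all bijections $\sigma$ of $\{ -n,\dots,-1,1,\dots,n\}$ with $\sigma(-i)=-\sigma(i)$, written in one-line notation $\sigma(1)\cdots\sigma(n)$. $\sigma$ has a peak at $i\in\{2,\dots,n-1\}$ if $\sigma(i-1)<\sigma(i)>\sigma(i+1)$; $Peak(\sigma)$ is the set of such $i$, $P^B(S;n)=\{\sigma\in S^B_n : Peak(\sigma)=S\}$, and $S$ is an admissible peak set if $P^B(S;n)\neq\emptyset$. Metrics: $d_H(\sigma,\rho)=|\{i\in[n]:\sigma(i)\ne\rho(i)\}|$; $d_\ell(\sigma,\rho)=\max_{i\in[n]}|\sigma(i)-\rho(i)|$; $d_W(\sigma,\pi)=\ell_B(\pi^{ -1}\sigma)$, where $\ell_B(\gamma)$ is the minimum number of factors needed to write $\gamma$ as a product of the Coxeter generators $s_0^B,\dots,s_{n-1}^B$: $s_0^B$ swaps $1$ and $-1$, and for $1\le i<n$, $s_i^B$ swaps $i$ with $i+1$ and $-i$ with $-(i+1)$. -}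

module Defs where

open import Data.Nat as ℕ using (ℕ; zero; suc; _≤_; _<_)
open import Data.Integer as ℤ using (ℤ; +_; -[1+_]; ∣_∣)
open import Data.Integer using () renaming (_<?_ to _<ℤ?_; _≟_ to _≟ℤ_)
open import Data.Fin as Fin using (Fin; toℕ)
open import Data.Vec as Vec using (Vec; tabulate; toList)
open import Data.List as List using (List; []; _∷_; map; upTo; length; foldr)
open import Data.List.Relation.Binary.Permutation.Propositional using (_↭_)
open import Data.Bool using (Bool; true; false; _∧_; if_then_else_)
open import Data.Product using (Σ; _×_; ∃; _,_)
open import Relation.Nullary.Decidable using (⌊_⌋)
open import Relation.Binary.PropositionalEquality using (_≡_)

-- A signed permutation of [±n] in one-line notation σ(1) ⋯ σ(n),
-- stored as a vector whose k-th entry (0-based) is σ(k+1).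
-- The condition: (|σ(1)|, …, |σ(n)|) is a rearrangement of (1, …, n).
-- (σ(-i) = -σ(i) is then the definition of σ on negatives, see `apply`.)
IsSignedPerm : {n : ℕ} → Vec ℤ n → Set
IsSignedPerm {n} w = map ∣_∣ (toList w) ↭ map suc (upTo n)

SB : ℕ → Set
SB n = Σ (Vec ℤ n) IsSignedPerm

nth : List ℤ → ℕ → ℤ
nth []       _       = + 0
nth (x ∷ xs) zero    = x
nth (x ∷ xs) (suc k) = nth xs k

apply : {n : ℕ} → Vec ℤ n → ℤ → ℤ
apply w (+ zero)    = + 0
apply w (+ (suc m)) = nth (toList w) m
apply w -[1+ m ]    = ℤ.- nth (toList w) m

_∘B_ : {n : ℕ} → Vec ℤ n → Vec ℤ n → Vec ℤ n
σ ∘B ρ = tabulate λ k → apply σ (Vec.lookup ρ k)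

idB : (n : ℕ) → Vec ℤ n
idB n = tabulate λ k → + suc (toℕ k)

-- inverse: σ⁻¹(j) = sign(σ(i)) · i where |σ(i)| = j
findInv : ℕ → List ℤ → ℕ → ℤ
findInv pos []       j = + 0
findInv pos (x ∷ xs) j with ⌊ ∣ x ∣ ℕ.≟ j ⌋
... | true  = if ⌊ x ℤ.<? + 0 ⌋ then -[1+ pos ] else + suc pos
... | false = findInv (suc pos) xs j

invB : {n : ℕ} → Vec ℤ n → Vec ℤ n
invB w = tabulate λ k → findInv 0 (toList w) (suc (toℕ k))

-- Coxeter generators s_0^B, …, s_{n-1}^B in one-line notation.
-- s_0: 1 ↦ -1; s_g (g ≥ 1): swaps g and g+1.
gen : {n : ℕ} → Fin n → Vec ℤ n
gen {n} g = tabulate λ k → entry (toℕ g) (toℕ k)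
  where
  -- k is 0-based position, i.e. position p = k+1
  entry : ℕ → ℕ → ℤ
  entry zero    zero    = -[1+ 0 ]
  entry zero    (suc k) = + suc (suc k)
  entry (suc g) k with ⌊ suc k ℕ.≟ suc g ⌋ | ⌊ suc k ℕ.≟ suc (suc g) ⌋
  ... | true  | _     = + suc (suc g)
  ... | false | true  = + suc g
  ... | false | false = + suc k

prod : {n : ℕ} → List (Fin n) → Vec ℤ n
prod {n} ws = foldr (λ g acc → gen g ∘B acc) (idB n) ws

LengthB : {n : ℕ} → Vec ℤ n → ℕ → Set
LengthB {n} γ k =
  (Σ (List (Fin n)) λ ws → length ws ≡ k × prod ws ≡ γ)
  × (∀ (ws : List (Fin n)) → prod ws ≡ γ → k ≤ length ws)

DW : {n : ℕ} → SB n → SB n → ℕ → Set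
DW (σ , _) (π , _) k = LengthB (invB π ∘B σ) k

dH : {n : ℕ} → SB n → SB n → ℕ
dH (σ , _) (ρ , _) = go (toList σ) (toList ρ)
  where
  go : List ℤ → List ℤ → ℕ
  go (x ∷ xs) (y ∷ ys) = (if ⌊ x ≟ℤ y ⌋ then 0 else 1) ℕ.+ go xs ys
  go _ _ = 0

dℓ : {n : ℕ} → SB n → SB n → ℕ
dℓ (σ , _) (ρ , _) = go (toList σ) (toList ρ)
  where
  go : List ℤ → List ℤ → ℕ
  go (x ∷ xs) (y ∷ ys) = ∣ x ℤ.- y ∣ ℕ.⊔ go xs ys
  go _ _ = 0

-- peak at 0-based position k (i.e. i = k+1 ∈ {2,…,n-1}):
-- σ(i-1) < σ(i) > σ(i+1)
peakAt : List ℤ → ℕ → Bool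
peakAt w zero    = false
peakAt w (suc k) =
  ⌊ suc (suc k) ℕ.<? length w ⌋
  ∧ ⌊ nth w k <ℤ? nth w (suc k) ⌋
  ∧ ⌊ nth w (suc (suc k)) <ℤ? nth w (suc k) ⌋

open import Data.Fin.Subset using (Subset)

Peak : {n : ℕ} → SB n → Subset n
Peak {n} s = tabulate λ k → peakAt (toList (Data.Product.proj₁ s)) (toℕ k)

InP : {n : ℕ} → Subset n → SB n → Set
InP S σ = Peak σ ≡ S

Admissible : {n : ℕ} → Subset n → Set
Admissible {n} S = ∃ λ (σ : SB n) → InP S σ

{-# OPTIONS --safe #-}
-- The peak set alone determines the canonical permutation
-- τ = 1 2 ⋯ n with the values i and i+1 exchanged at every peak i; its first entry is 1,
-- since position 1 is never a peak. Relabelling the values of τ by a strictly increasing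
-- map keeps every peak, and s₀ (1 ↦ -1) and s₁s₀ (1 ↦ -2, 2 ↦ 1) are strictly increasing
-- on positive values. So τs₀ and s₁s₀τ also have peak set S; τs₀ differs from τ only in
-- the sign of its first entry (Hamming and Weyl distance 1), and the entries of s₁s₀τ
-- differ from those of τs₀ by at most 1. The lower bounds hold because each distance
-- vanishes only on equal permutations.
module Submission where

open import Defs
open import Data.Nat using (ℕ; _≤_; _≥_)
open import Data.Fin.Subset using (Subset)
open import Data.Product using (Σ; _×_; proj₁)
open import Relation.Binary.PropositionalEquality using (_≡_; _≢_)

open import Data.Bool using (Bool; true; false; if_then_else_; _∧_)
open import Data.Bool.Properties using (∧-conicalˡ; ∧-conicalʳ; ∧-zeroʳ; ¬-not)
import Data.Bool.Properties as Boolₚ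
open import Data.Nat as ℕ using (zero; suc; pred; z≤n; s≤s; _<_; _+_; _⊔_)
import Data.Nat.Properties as ℕₚ
open import Data.Integer as ℤ using (ℤ; +_; -[1+_]; ∣_∣; -_; _-_)
import Data.Integer.Properties as ℤₚ
open import Data.Fin as Fin using (Fin; toℕ)
import Data.Fin.Properties as Finₚ
open import Data.Product using (_,_; proj₂; ∃)
open import Data.Sum using (_⊎_; inj₁; inj₂)
open import Data.List as List using (List; []; _∷_; map; upTo; applyUpTo; iterate; length)
import Data.List.Properties as Listₚ
open import Data.List.Membership.Propositional using (_∈_)
import Data.List.Membership.Propositional.Properties as ∈ₚ
open import Data.List.Relation.Unary.All as All using ()
open import Data.List.Relation.Unary.AllPairs using (_∷_)
open import Data.List.Relation.Unary.Any using (here; there)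
open import Data.List.Relation.Unary.Unique.Propositional using (Unique)
import Data.List.Relation.Unary.Unique.Propositional.Properties as Uniqueₚ
open import Data.List.Relation.Binary.Permutation.Propositional
  using (_↭_; ↭-refl; ↭-sym; ↭-reflexive; prep; swap; ↭⇒↭ₛ; module PermutationReasoning)
import Data.List.Relation.Binary.Permutation.Propositional.Properties as ↭ₚ
import Data.List.Relation.Binary.Permutation.Setoid.Properties as ↭ₛₚ
open import Data.Vec as Vec using (Vec; _∷_; tabulate; lookup; toList)
import Data.Vec.Properties as Vecₚ
import Data.Vec.Membership.Propositional.Properties as Vec∈ₚ
import Data.Vec.Relation.Unary.Any as VecAny
import Data.Vec.Relation.Unary.Any.Properties as VecAnyₚ
open import Data.Vec.Relation.Binary.Pointwise.Extensional using (ext; Pointwise-≡⇒≡)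
open import Function using (_∘_)
open import Function.Bundles using (mk⇔)
open import Relation.Binary.Core using (_Preserves_⟶_)
open import Relation.Binary.Definitions using (tri<; tri≈; tri>)
open import Relation.Binary.PropositionalEquality
  using (refl; sym; trans; cong; cong₂; subst; subst₂; setoid; module ≡-Reasoning)
open import Relation.Nullary using (yes; no; ¬_; contradiction)
open import Relation.Nullary.Decidable using (Dec; ⌊_⌋; dec-true; dec-false; does-⇔; isYes≗does)

⌊⌋-true : ∀ {a} {A : Set a} (a? : Dec A) → A → ⌊ a? ⌋ ≡ true
⌊⌋-true a? a = trans (isYes≗does a?) (dec-true a? a)

⌊⌋-false : ∀ {a} {A : Set a} (a? : Dec A) → ¬ A → ⌊ a? ⌋ ≡ false
⌊⌋-false a? ¬a = trans (isYes≗does a?) (dec-false a? ¬a)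

⌊⌋≡true⇒ : ∀ {a} {A : Set a} (a? : Dec A) → ⌊ a? ⌋ ≡ true → A
⌊⌋≡true⇒ (yes a) _ = a

∧∧-≡ : ∀ {a b c d : Bool} →
  (d ≡ true → a ≡ true × b ≡ true × c ≡ true) → (d ≡ false → c ≡ false) → a ∧ b ∧ c ≡ d
∧∧-≡ {d = true} all-true _ with all-true refl
... | refl , refl , refl = refl
∧∧-≡ {a} {b} {d = false} _ c-false rewrite c-false refl | ∧-zeroʳ b = ∧-zeroʳ a

nth-toList : ∀ {n} (v : Vec ℤ n) (i : Fin n) → nth (toList v) (toℕ i) ≡ lookup v i
nth-toList (x ∷ v) Fin.zero    = refl
nth-toList (x ∷ v) (Fin.suc i) = nth-toList v i

nth-tabulate : ∀ (g : ℕ → ℤ) {n k} → k < n → nth (toList (tabulate {n = n} (g ∘ toℕ))) k ≡ g k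
nth-tabulate g {suc n} {zero}  _       = refl
nth-tabulate g {suc n} {suc k} (s≤s k<n) = nth-tabulate (g ∘ suc) k<n

nth∈ : ∀ xs {p} → p < length xs → nth xs p ∈ xs
nth∈ (x ∷ xs) {zero}  _         = here refl
nth∈ (x ∷ xs) {suc p} (s≤s p<n) = there (nth∈ xs p<n)

iterate-suc-shift : ∀ i k → iterate suc (suc i) k ≡ map suc (iterate suc i k)
iterate-suc-shift i zero    = refl
iterate-suc-shift i (suc k) = cong (suc i ∷_) (iterate-suc-shift (suc i) k)

iterate-suc-0≡upTo : ∀ n → iterate suc 0 n ≡ upTo n
iterate-suc-0≡upTo zero    = refl
iterate-suc-0≡upTo (suc n) = cong (0 ∷_) (begin
  iterate suc 1 n           ≡⟨ iterate-suc-shift 0 n ⟩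
  map suc (iterate suc 0 n) ≡⟨ cong (map suc) (iterate-suc-0≡upTo n) ⟩
  map suc (upTo n)          ≡⟨ Listₚ.map-upTo suc n ⟩
  applyUpTo suc n           ∎)
  where open ≡-Reasoning

toList-tabulate : ∀ {a} {A : Set a} (g : ℕ → A) n →
  toList (tabulate {n = n} (g ∘ toℕ)) ≡ map g (upTo n)
toList-tabulate g zero    = refl
toList-tabulate g (suc n) = cong (g 0 ∷_) (begin
  toList (tabulate (g ∘ suc ∘ toℕ)) ≡⟨ toList-tabulate (g ∘ suc) n ⟩
  map (g ∘ suc) (upTo n)             ≡⟨ Listₚ.map-∘ (upTo n) ⟩
  map g (map suc (upTo n))           ≡⟨ cong (map g) (Listₚ.map-upTo suc n) ⟩
  map g (applyUpTo suc n)            ∎)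
  where open ≡-Reasoning

-- Hamming and ℓ∞ distances

module _ (f : ℤ → ℤ → ℕ) (_⊕_ : ℕ → ℕ → ℕ) where

  zipFold : List ℤ → List ℤ → ℕ
  zipFold (x ∷ xs) (y ∷ ys) = f x y ⊕ zipFold xs ys
  zipFold _        _        = 0

  zipFold-unique : (G : List ℤ → List ℤ → ℕ) →
    (∀ ys → G [] ys ≡ 0) → (∀ x xs → G (x ∷ xs) [] ≡ 0) →
    (∀ x xs y ys → G (x ∷ xs) (y ∷ ys) ≡ f x y ⊕ G xs ys) →
    ∀ xs ys → G xs ys ≡ zipFold xs ys
  zipFold-unique G nil-l nil-r cons []       ys       = nil-l ys
  zipFold-unique G nil-l nil-r cons (x ∷ xs) []       = nil-r x xs
  zipFold-unique G nil-l nil-r cons (x ∷ xs) (y ∷ ys) =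
    trans (cons x xs y ys) (cong (f x y ⊕_) (zipFold-unique G nil-l nil-r cons xs ys))

  zipFold≡0⇒≡ : (∀ {x y} → f x y ≡ 0 → x ≡ y) →
    (∀ a b → a ≤ a ⊕ b) → (∀ a b → b ≤ a ⊕ b) →
    ∀ {n} (u v : Vec ℤ n) → zipFold (toList u) (toList v) ≡ 0 → u ≡ v
  zipFold≡0⇒≡ f≡0⇒≡ x≤x⊕y y≤x⊕y Vec.[]  Vec.[]  _ = refl
  zipFold≡0⇒≡ f≡0⇒≡ x≤x⊕y y≤x⊕y (x ∷ u) (y ∷ v) e =
    cong₂ _∷_ (f≡0⇒≡ (ℕₚ.n≤0⇒n≡0 (subst (f x y ≤_) e (x≤x⊕y _ _))))
              (zipFold≡0⇒≡ f≡0⇒≡ x≤x⊕y y≤x⊕y u v (ℕₚ.n≤0⇒n≡0 (subst (rest ≤_) e (y≤x⊕y _ _))))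
    where
    rest : ℕ
    rest = zipFold (toList u) (toList v)

mismatch : ℤ → ℤ → ℕ
mismatch x y = if ⌊ x ℤ.≟ y ⌋ then 0 else 1

hamming : List ℤ → List ℤ → ℕ
hamming = zipFold mismatch _+_

chebyshev : List ℤ → List ℤ → ℕ
chebyshev = zipFold (λ x y → ∣ x - y ∣) _⊔_

-- The recursion of dH and dℓ is a local function of Defs; with-abstracting the two lists
-- lets unification identify it with the G of zipFold-unique.
dH≡hamming : ∀ {n} (σ ρ : SB n) → dH σ ρ ≡ hamming (toList (proj₁ σ)) (toList (proj₁ ρ))
dH≡hamming σ ρ
  with zipFold-unique mismatch _+_ _ (λ _ → refl) (λ _ _ → refl) (λ _ _ _ _ → refl)
     | toList (proj₁ σ) | toList (proj₁ ρ)
... | go≡hamming | xs | ys = go≡hamming xs ys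

dℓ≡chebyshev : ∀ {n} (σ ρ : SB n) → dℓ σ ρ ≡ chebyshev (toList (proj₁ σ)) (toList (proj₁ ρ))
dℓ≡chebyshev σ ρ
  with zipFold-unique (λ x y → ∣ x - y ∣) _⊔_ _ (λ _ → refl) (λ _ _ → refl) (λ _ _ _ _ → refl)
     | toList (proj₁ σ) | toList (proj₁ ρ)
... | go≡chebyshev | xs | ys = go≡chebyshev xs ys

mismatch≡0⇒≡ : ∀ {x y} → mismatch x y ≡ 0 → x ≡ y
mismatch≡0⇒≡ {x} {y} e with x ℤ.≟ y
... | yes x≡y = x≡y

≢⇒1≤dH : ∀ {n} (σ ρ : SB n) → proj₁ σ ≢ proj₁ ρ → 1 ≤ dH σ ρ
≢⇒1≤dH σ ρ σ≢ρ = ℕₚ.n≢0⇒n>0 λ dH≡0 → σ≢ρ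
  (zipFold≡0⇒≡ mismatch _+_ mismatch≡0⇒≡ ℕₚ.m≤m+n (λ a b → ℕₚ.m≤n+m b a)
    (proj₁ σ) (proj₁ ρ) (trans (sym (dH≡hamming σ ρ)) dH≡0))

≢⇒1≤dℓ : ∀ {n} (σ ρ : SB n) → proj₁ σ ≢ proj₁ ρ → 1 ≤ dℓ σ ρ
≢⇒1≤dℓ σ ρ σ≢ρ = ℕₚ.n≢0⇒n>0 λ dℓ≡0 → σ≢ρ
  (zipFold≡0⇒≡ _ _⊔_ (λ {x} {y} e → ℤₚ.i-j≡0⇒i≡j x y (ℤₚ.∣i∣≡0⇒i≡0 e)) ℕₚ.m≤m⊔n ℕₚ.m≤n⊔m
    (proj₁ σ) (proj₁ ρ) (trans (sym (dℓ≡chebyshev σ ρ)) dℓ≡0))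

mismatch-refl : ∀ x → mismatch x x ≡ 0
mismatch-refl x with x ℤ.≟ x
... | yes _   = refl
... | no x≢x = contradiction refl x≢x

mismatch-≢ : ∀ {x y} → x ≢ y → mismatch x y ≡ 1
mismatch-≢ {x} {y} x≢y with x ℤ.≟ y
... | yes x≡y = contradiction x≡y x≢y
... | no _    = refl

hamming-refl : ∀ xs → hamming xs xs ≡ 0
hamming-refl []       = refl
hamming-refl (x ∷ xs) = cong₂ _+_ (mismatch-refl x) (hamming-refl xs)

chebyshev≤ : ∀ {n d} (u v : Vec ℤ n) → (∀ i → ∣ lookup u i - lookup v i ∣ ≤ d) →
  chebyshev (toList u) (toList v) ≤ d
chebyshev≤ Vec.[]  Vec.[]  _     = z≤n
chebyshev≤ (x ∷ u) (y ∷ v) close = ℕₚ.⊔-lub (close Fin.zero) (chebyshev≤ u v (close ∘ Fin.suc))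

-- Entries, inverses and the Weyl distance

∈-toList⇒lookup : ∀ {a} {A : Set a} {n} {x} {v : Vec A n} → x ∈ toList v → ∃ λ i → x ≡ lookup v i
∈-toList⇒lookup x∈v = VecAny.index x∈ᵥv , VecAnyₚ.lookup-index x∈ᵥv
  where x∈ᵥv = Vec∈ₚ.∈-toList⁻ x∈v

∣lookup∣≡suc : ∀ {n} (σ : SB n) (i : Fin n) → ∃ λ m → m < n × ∣ lookup (proj₁ σ) i ∣ ≡ suc m
∣lookup∣≡suc (σ , σ↭) i
  with ∈ₚ.∈-map⁻ suc (↭ₚ.∈-resp-↭ σ↭ (∈ₚ.∈-map⁺ ∣_∣ (Vec∈ₚ.∈-toList⁺ (Vec∈ₚ.∈-lookup i σ))))
... | m , m∈ , e = m , ∈ₚ.∈-upTo⁻ m∈ , e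

∣lookup∣-surjective : ∀ {n} (ρ : SB n) {m} → m < n → ∃ λ p → suc m ≡ ∣ lookup (proj₁ ρ) p ∣
∣lookup∣-surjective (ρ , ρ↭) m<n
  with ∈ₚ.∈-map⁻ ∣_∣ (↭ₚ.∈-resp-↭ (↭-sym ρ↭) (∈ₚ.∈-map⁺ suc (∈ₚ.∈-upTo⁺ m<n)))
... | y , y∈ρ , 1+m≡∣y∣ with ∈-toList⇒lookup y∈ρ
... | p , y≡ρₚ = p , trans 1+m≡∣y∣ (cong ∣_∣ y≡ρₚ)

map-∣∣-unique : ∀ {n} (σ : SB n) → Unique (map ∣_∣ (toList (proj₁ σ)))
map-∣∣-unique {n} (σ , σ↭) =
  ↭ₛₚ.Unique-resp-↭ (setoid ℕ) (↭⇒↭ₛ (↭-sym σ↭)) (Uniqueₚ.map⁺ ℕₚ.suc-injective (Uniqueₚ.upTo⁺ n))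

∣i∣≡∣j∣⇒i≡j⊎i≡-j : ∀ i j → ∣ i ∣ ≡ ∣ j ∣ → i ≡ j ⊎ i ≡ - j
∣i∣≡∣j∣⇒i≡j⊎i≡-j (+ zero)  (+ zero)   _    = inj₁ refl
∣i∣≡∣j∣⇒i≡j⊎i≡-j (+ suc m) (+ suc .m)  refl = inj₁ refl
∣i∣≡∣j∣⇒i≡j⊎i≡-j (+ suc m) -[1+ .m ]   refl = inj₂ refl
∣i∣≡∣j∣⇒i≡j⊎i≡-j -[1+ m ]  (+ suc .m)  refl = inj₂ refl
∣i∣≡∣j∣⇒i≡j⊎i≡-j -[1+ m ]  -[1+ .m ]   refl = inj₁ refl

signedSuc : ℤ → ℕ → ℤ
signedSuc x k = if ⌊ x ℤ.<? + 0 ⌋ then -[1+ k ] else + suc k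

findInv-nth : ∀ xs i {p} → Unique (map ∣_∣ xs) → p < length xs →
  findInv i xs ∣ nth xs p ∣ ≡ signedSuc (nth xs p) (i + p)
findInv-nth (x ∷ xs) i {zero} _ _
  rewrite ⌊⌋-true (∣ x ∣ ℕ.≟ ∣ x ∣) refl | ℕₚ.+-identityʳ i = refl
findInv-nth (x ∷ xs) i {suc p} (x∉xs ∷ unique) (s≤s p<n)
  rewrite ⌊⌋-false (∣ x ∣ ℕ.≟ ∣ nth xs p ∣) (All.lookup x∉xs (∈ₚ.∈-map⁺ ∣_∣ (nth∈ xs p<n)))
        | ℕₚ.+-suc i p = findInv-nth xs (suc i) unique p<n

nth-invB : ∀ {n} (ρ : SB n) (i : Fin n) {m} → m < n → ∣ lookup (proj₁ ρ) i ∣ ≡ suc m →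
  nth (toList (invB (proj₁ ρ))) m ≡ signedSuc (lookup (proj₁ ρ) i) (toℕ i)
nth-invB {n} (ρ , ρ↭) i {m} m<n ∣ρᵢ∣≡1+m = begin
  nth (toList (invB ρ)) m
    ≡⟨ nth-tabulate (findInv 0 (toList ρ) ∘ suc) m<n ⟩
  findInv 0 (toList ρ) (suc m)
    ≡⟨ cong (findInv 0 (toList ρ)) (trans (sym ∣ρᵢ∣≡1+m) (cong ∣_∣ (sym (nth-toList ρ i)))) ⟩
  findInv 0 (toList ρ) ∣ nth (toList ρ) (toℕ i) ∣
    ≡⟨ findInv-nth (toList ρ) 0 (map-∣∣-unique (ρ , ρ↭)) i<length ⟩
  signedSuc (nth (toList ρ) (toℕ i)) (toℕ i)
    ≡⟨ cong (λ x → signedSuc x (toℕ i)) (nth-toList ρ i) ⟩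
  signedSuc (lookup ρ i) (toℕ i)
    ∎
  where
  open ≡-Reasoning
  i<length : toℕ i < length (toList ρ)
  i<length = subst (toℕ i <_) (sym (Vecₚ.length-toList ρ)) (Finₚ.toℕ<n i)

apply-signedSuc : ∀ {n} (w : Vec ℤ n) y {m k} →
  ∣ y ∣ ≡ suc m → nth (toList w) m ≡ signedSuc y k → apply w y ≡ + suc k
apply-signedSuc w (+ suc m) refl e = e
apply-signedSuc w -[1+ m ]  refl e = cong -_ e

apply-neg : ∀ {n} (w : Vec ℤ n) y → apply w (- y) ≡ - apply w y
apply-neg w (+ zero)  = refl
apply-neg w (+ suc m) = refl
apply-neg w -[1+ m ]  = sym (ℤₚ.neg-involutive _)

apply-invB-lookup : ∀ {n} (ρ : SB n) (i : Fin n) →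
  apply (invB (proj₁ ρ)) (lookup (proj₁ ρ) i) ≡ + suc (toℕ i)
apply-invB-lookup ρ i with ∣lookup∣≡suc ρ i
... | m , m<n , ∣ρᵢ∣≡1+m =
  apply-signedSuc (invB (proj₁ ρ)) (lookup (proj₁ ρ) i) ∣ρᵢ∣≡1+m (nth-invB ρ i m<n ∣ρᵢ∣≡1+m)

lookup-∘B : ∀ {n} (σ ρ : Vec ℤ n) i → lookup (σ ∘B ρ) i ≡ apply σ (lookup ρ i)
lookup-∘B σ ρ = Vecₚ.lookup∘tabulate _

lookup-idB : ∀ n i → lookup (idB n) i ≡ + suc (toℕ i)
lookup-idB n = Vecₚ.lookup∘tabulate _

∘B-identityʳ : ∀ {n} (w : Vec ℤ n) → w ∘B idB n ≡ w
∘B-identityʳ {n} w = Pointwise-≡⇒≡ (ext λ i → begin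
  lookup (w ∘B idB n) i          ≡⟨ lookup-∘B w (idB n) i ⟩
  apply w (lookup (idB n) i)     ≡⟨ cong (apply w) (lookup-idB n i) ⟩
  nth (toList w) (toℕ i)         ≡⟨ nth-toList w i ⟩
  lookup w i                     ∎)
  where open ≡-Reasoning

-- σ(i) = ±ρ(p) for the p with |ρ(p)| = |σ(i)|, and ρ⁻¹σ(i) = i + 1 forces the sign + and p = i.
invB-∘B≡idB⇒≡ : ∀ {n} (σ ρ : SB n) → idB n ≡ invB (proj₁ ρ) ∘B proj₁ σ → proj₁ σ ≡ proj₁ ρ
invB-∘B≡idB⇒≡ {n} σ ρ id≡ρ⁻¹σ = Pointwise-≡⇒≡ (ext σᵢ≡ρᵢ)
  where
  ρ⁻¹ : ℤ → ℤ
  ρ⁻¹ = apply (invB (proj₁ ρ))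

  ρ⁻¹σᵢ : ∀ i → ρ⁻¹ (lookup (proj₁ σ) i) ≡ + suc (toℕ i)
  ρ⁻¹σᵢ i = begin
    ρ⁻¹ (lookup (proj₁ σ) i)                   ≡⟨ lookup-∘B (invB (proj₁ ρ)) (proj₁ σ) i ⟨
    lookup (invB (proj₁ ρ) ∘B proj₁ σ) i       ≡⟨ cong (λ v → lookup v i) id≡ρ⁻¹σ ⟨
    lookup (idB n) i                           ≡⟨ lookup-idB n i ⟩
    + suc (toℕ i)                              ∎
    where open ≡-Reasoning

  σᵢ≡ρᵢ : ∀ i → lookup (proj₁ σ) i ≡ lookup (proj₁ ρ) i
  σᵢ≡ρᵢ i with ∣lookup∣≡suc σ i
  ... | m , m<n , ∣σᵢ∣≡1+m with ∣lookup∣-surjective ρ m<n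
  ... | p , 1+m≡∣ρₚ∣
    with ∣i∣≡∣j∣⇒i≡j⊎i≡-j (lookup (proj₁ σ) i) (lookup (proj₁ ρ) p) (trans ∣σᵢ∣≡1+m 1+m≡∣ρₚ∣)
  ... | inj₁ σᵢ≡ρₚ
    with Finₚ.toℕ-injective (ℕₚ.suc-injective (ℤₚ.+-injective
           (trans (sym (ρ⁻¹σᵢ i)) (trans (cong ρ⁻¹ σᵢ≡ρₚ) (apply-invB-lookup ρ p)))))
  ...   | refl = σᵢ≡ρₚ
  σᵢ≡ρᵢ i | _ | p , _ | inj₂ σᵢ≡-ρₚ
    with trans (sym (ρ⁻¹σᵢ i)) (trans (cong ρ⁻¹ σᵢ≡-ρₚ)
           (trans (apply-neg (invB (proj₁ ρ)) (lookup (proj₁ ρ) p)) (cong -_ (apply-invB-lookup ρ p))))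
  ...   | ()

≢⇒1≤length : ∀ {n} (σ ρ : SB n) → proj₁ σ ≢ proj₁ ρ →
  ∀ ws → prod ws ≡ invB (proj₁ ρ) ∘B proj₁ σ → 1 ≤ length ws
≢⇒1≤length σ ρ σ≢ρ []      id≡ρ⁻¹σ = contradiction (invB-∘B≡idB⇒≡ σ ρ id≡ρ⁻¹σ) σ≢ρ
≢⇒1≤length σ ρ σ≢ρ (_ ∷ _) _       = s≤s z≤n

≢⇒1≤DW : ∀ {n} (σ ρ : SB n) → proj₁ σ ≢ proj₁ ρ → ∀ k → DW σ ρ k → 1 ≤ k
≢⇒1≤DW σ ρ σ≢ρ _ ((ws , refl , prod≡ρ⁻¹σ) , _) = ≢⇒1≤length σ ρ σ≢ρ ws prod≡ρ⁻¹σ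

generator⇒DW≡1 : ∀ {n} (σ ρ : SB n) → proj₁ σ ≢ proj₁ ρ →
  (g : Fin n) → invB (proj₁ ρ) ∘B proj₁ σ ≡ gen g → DW σ ρ 1
generator⇒DW≡1 σ ρ σ≢ρ g ρ⁻¹σ≡g =
  (g ∷ [] , refl , trans (∘B-identityʳ (gen g)) (sym ρ⁻¹σ≡g)) , ≢⇒1≤length σ ρ σ≢ρ

negateHead : ∀ {n} → Vec ℤ (suc n) → Vec ℤ (suc n)
negateHead (x ∷ xs) = - x ∷ xs

∣i∣≡1+m⇒i≢-i : ∀ {i m} → ∣ i ∣ ≡ suc m → i ≢ - i
∣i∣≡1+m⇒i≢-i {+ suc _}  _ ()
∣i∣≡1+m⇒i≢-i { -[1+ _ ]} _ ()

head≢-head : ∀ {n} (σ : SB (suc n)) → Vec.head (proj₁ σ) ≢ - Vec.head (proj₁ σ)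
head≢-head σ@(_ ∷ _ , _) with ∣lookup∣≡suc σ Fin.zero
... | _ , _ , ∣σ₀∣≡1+m = ∣i∣≡1+m⇒i≢-i ∣σ₀∣≡1+m

≢-negateHead : ∀ {n} (σ : SB (suc n)) → proj₁ σ ≢ negateHead (proj₁ σ)
≢-negateHead σ@(_ ∷ _ , _) σ≡ = head≢-head σ (cong Vec.head σ≡)

dH-negateHead : ∀ {n} (σ ρ : SB (suc n)) → proj₁ ρ ≡ negateHead (proj₁ σ) → dH σ ρ ≡ 1
dH-negateHead σ@(x ∷ xs , _) ρ@(_ , _) refl = begin
  dH σ ρ
    ≡⟨ dH≡hamming σ ρ ⟩
  mismatch x (- x) + hamming (toList xs) (toList xs)
    ≡⟨ cong₂ _+_ (mismatch-≢ (head≢-head σ)) (hamming-refl (toList xs)) ⟩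
  1 ∎
  where open ≡-Reasoning

invB-∘B-negateHead : ∀ {n} (σ ρ : SB (suc n)) → proj₁ ρ ≡ negateHead (proj₁ σ) →
  invB (proj₁ ρ) ∘B proj₁ σ ≡ gen Fin.zero
invB-∘B-negateHead {n} (x ∷ xs , _) ρ@(_ , _) refl = Pointwise-≡⇒≡ (ext λ i →
  trans (lookup-∘B ρ⁻¹ (x ∷ xs) i) (ρ⁻¹σᵢ≡s₀ᵢ i))
  where
  open ≡-Reasoning
  ρ⁻¹ : Vec ℤ (suc n)
  ρ⁻¹ = invB (- x ∷ xs)

  ρ⁻¹σᵢ≡s₀ᵢ : ∀ i → apply ρ⁻¹ (lookup (x ∷ xs) i) ≡ lookup (gen Fin.zero) i
  ρ⁻¹σᵢ≡s₀ᵢ Fin.zero = begin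
    apply ρ⁻¹ x         ≡⟨ cong (apply ρ⁻¹) (ℤₚ.neg-involutive x) ⟨
    apply ρ⁻¹ (- (- x)) ≡⟨ apply-neg ρ⁻¹ (- x) ⟩
    - apply ρ⁻¹ (- x)   ≡⟨ cong -_ (apply-invB-lookup ρ Fin.zero) ⟩
    -[1+ 0 ]            ∎
  ρ⁻¹σᵢ≡s₀ᵢ (Fin.suc k) = trans (apply-invB-lookup ρ (Fin.suc k)) (sym (Vecₚ.lookup∘tabulate _ k))

-- Peaks

peakAt⇒< : ∀ w k → peakAt w k ≡ true → suc k < length w
peakAt⇒< w (suc k) peak = ⌊⌋≡true⇒ (suc (suc k) ℕ.<? length w) (∧-conicalˡ _ _ peak)

peakAt-ascent : ∀ w k → peakAt w (suc k) ≡ true → nth w k ℤ.< nth w (suc k)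
peakAt-ascent w k peak = ⌊⌋≡true⇒ (nth w k ℤ.<? nth w (suc k))
  (∧-conicalˡ _ ⌊ nth w (suc (suc k)) ℤ.<? nth w (suc k) ⌋
    (∧-conicalʳ ⌊ suc (suc k) ℕ.<? length w ⌋ _ peak))

peakAt-descent : ∀ w k → peakAt w (suc k) ≡ true → nth w (suc (suc k)) ℤ.< nth w (suc k)
peakAt-descent w k peak = ⌊⌋≡true⇒ (nth w (suc (suc k)) ℤ.<? nth w (suc k))
  (∧-conicalʳ ⌊ nth w k ℤ.<? nth w (suc k) ⌋ _ (∧-conicalʳ ⌊ suc (suc k) ℕ.<? length w ⌋ _ peak))

peakAt-next≡false : ∀ w k → peakAt w k ≡ true → peakAt w (suc k) ≡ false
peakAt-next≡false w (suc k) peak =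
  ¬-not λ next → ℤₚ.<-asym (peakAt-descent w k peak) (peakAt-ascent w (suc k) next)

peakAt-tabulate : ∀ (h : ℕ → ℤ) {n} k → peakAt (toList (tabulate {n = n} (h ∘ toℕ))) (suc k) ≡
  ⌊ suc (suc k) ℕ.<? n ⌋ ∧ ⌊ h k ℤ.<? h (suc k) ⌋ ∧ ⌊ h (suc (suc k)) ℤ.<? h (suc k) ⌋
peakAt-tabulate h {n} k rewrite Vecₚ.length-toList (tabulate {n = n} (h ∘ toℕ))
  with suc (suc k) ℕ.<? n
... | no _ = refl
... | yes k+2<n
  rewrite nth-tabulate h (ℕₚ.<⇒≤ (ℕₚ.<⇒≤ k+2<n)) | nth-tabulate h (ℕₚ.<⇒≤ k+2<n) | nth-tabulate h k+2<n
  = refl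

<?-preserved : ∀ {f : ℕ → ℤ} → f Preserves _<_ ⟶ ℤ._<_ → ∀ x y → ⌊ f x ℤ.<? f y ⌋ ≡ ⌊ x ℕ.<? y ⌋
<?-preserved {f} f-mono x y =
  trans (isYes≗does (f x ℤ.<? f y))
    (trans (does-⇔ (mk⇔ reflects f-mono) (f x ℤ.<? f y) (x ℕ.<? y)) (sym (isYes≗does (x ℕ.<? y))))
  where
  reflects : f x ℤ.< f y → x < y
  reflects fx<fy with ℕₚ.<-cmp x y
  ... | tri< x<y _ _ = x<y
  ... | tri≈ _ refl _ = contradiction fx<fy (ℤₚ.<-irrefl refl)
  ... | tri> _ _ y<x = contradiction fx<fy (ℤₚ.<-asym (f-mono y<x))

record PeakPattern (n : ℕ) : Set where
  field
    isPeak          : ℕ → Bool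
    peak₀≡false     : isPeak 0 ≡ false
    peak⇒<          : ∀ p → isPeak p ≡ true → suc p < n
    peak⇒next≡false : ∀ p → isPeak p ≡ true → isPeak (suc p) ≡ false

peakPattern : ∀ {n} → Vec ℤ n → PeakPattern n
peakPattern σ = record
  { isPeak          = peakAt (toList σ)
  ; peak₀≡false     = refl
  ; peak⇒<          = λ p peak → subst (suc p <_) (Vecₚ.length-toList σ) (peakAt⇒< (toList σ) p peak)
  ; peak⇒next≡false = peakAt-next≡false (toList σ)
  }

-- value p is the entry at 0-based position p of 1 2 ⋯ n with the values p+1 and p+2
-- exchanged at every peak p.
module Canonical {n} (P : PeakPattern n) where
  open PeakPattern P

  value : ℕ → ℕ
  value p = if isPeak p then suc (suc p) else if isPeak (pred p) then p else suc p

  value-peak : ∀ {p} → isPeak p ≡ true → value p ≡ suc (suc p)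
  value-peak peak rewrite peak = refl

  value-after-peak : ∀ {p} → isPeak p ≡ true → value (suc p) ≡ suc p
  value-after-peak {p} peak rewrite peak⇒next≡false p peak | peak = refl

  value-unmoved : ∀ {p} → isPeak p ≡ false → isPeak (pred p) ≡ false → value p ≡ suc p
  value-unmoved not-peak before rewrite not-peak | before = refl

  value-≤ : ∀ {p} → isPeak p ≡ false → value p ≤ suc p
  value-≤ {p} not-peak rewrite not-peak with isPeak (pred p)
  ... | true  = ℕₚ.n≤1+n p
  ... | false = ℕₚ.≤-refl

  value-≥ : ∀ {p} → isPeak p ≡ false → suc (suc p) ≤ value (suc p)
  value-≥ {p} not-peak rewrite not-peak with isPeak (suc p)
  ... | true  = ℕₚ.n≤1+n _
  ... | false = ℕₚ.≤-refl

  value-rises : ∀ {p} → isPeak p ≡ false → value p < value (suc p)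
  value-rises not-peak = ℕₚ.≤-trans (s≤s (value-≤ not-peak)) (value-≥ not-peak)

  value-falls : ∀ {p} → isPeak p ≡ true → value (suc p) < value p
  value-falls peak = subst₂ _<_ (sym (value-after-peak peak)) (sym (value-peak peak)) (ℕₚ.n<1+n _)

  peak⇒previous≡false : ∀ p → isPeak (suc p) ≡ true → isPeak p ≡ false
  peak⇒previous≡false p peak =
    ¬-not λ previous → contradiction (trans (sym peak) (peak⇒next≡false p previous)) λ ()

  canonical-peak : ∀ k →
    ⌊ suc (suc k) ℕ.<? n ⌋ ∧ ⌊ value k ℕ.<? value (suc k) ⌋ ∧ ⌊ value (suc (suc k)) ℕ.<? value (suc k) ⌋
      ≡ isPeak (suc k)
  canonical-peak k = ∧∧-≡
    (λ peak → ⌊⌋-true (suc (suc k) ℕ.<? n) (peak⇒< (suc k) peak)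
            , ⌊⌋-true (value k ℕ.<? value (suc k)) (value-rises (peak⇒previous≡false k peak))
            , ⌊⌋-true (value (suc (suc k)) ℕ.<? value (suc k)) (value-falls peak))
    (λ not-peak → ⌊⌋-false (value (suc (suc k)) ℕ.<? value (suc k)) (ℕₚ.<⇒≯ (value-rises not-peak)))

  value-↭ : ∀ k i → i + k ≡ n → isPeak (pred i) ≡ false →
    map value (iterate suc i k) ↭ map suc (iterate suc i k)
  value-↭ zero    i _     _      = ↭-refl
  value-↭ (suc k) i i+k≡n before with isPeak i Boolₚ.≟ true
  ... | no not-peak rewrite value-unmoved (¬-not not-peak) before =
    prep (suc i) (value-↭ k (suc i) (trans (sym (ℕₚ.+-suc i k)) i+k≡n) (¬-not not-peak))
  value-↭ (suc zero) i i+1≡n _ | yes peak =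
    contradiction (subst (suc i <_) (sym i+1≡n) (peak⇒< i peak)) (ℕₚ.<-irrefl (ℕₚ.+-comm 1 i))
  value-↭ (suc (suc k)) i i+k≡n _ | yes peak rewrite value-peak peak | value-after-peak peak =
    swap (suc (suc i)) (suc i) (value-↭ k (suc (suc i)) i+2+k≡n (peak⇒next≡false i peak))
    where
    i+2+k≡n : suc (suc i) + k ≡ n
    i+2+k≡n = trans (sym (trans (ℕₚ.+-suc i (suc k)) (cong suc (ℕₚ.+-suc i k)))) i+k≡n

  canonical-↭ : map value (upTo n) ↭ map suc (upTo n)
  canonical-↭ =
    subst (λ xs → map value xs ↭ map suc xs) (iterate-suc-0≡upTo n) (value-↭ n 0 refl peak₀≡false)

  word : (ℕ → ℤ) → Vec ℤ n
  word f = tabulate (f ∘ value ∘ toℕ)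

  word-isSignedPerm : ∀ f → map (∣_∣ ∘ f) (map suc (upTo n)) ↭ map suc (upTo n) →
    IsSignedPerm (word f)
  word-isSignedPerm f ∣f∣↭ = begin
    map ∣_∣ (toList (word f))          ≡⟨ cong (map ∣_∣) (toList-tabulate (f ∘ value) n) ⟩
    map ∣_∣ (map (f ∘ value) (upTo n)) ≡⟨ Listₚ.map-∘ (upTo n) ⟨
    map (∣_∣ ∘ f ∘ value) (upTo n)     ≡⟨ Listₚ.map-∘ (upTo n) ⟩
    map (∣_∣ ∘ f) (map value (upTo n)) ↭⟨ ↭ₚ.map⁺ (∣_∣ ∘ f) canonical-↭ ⟩
    map (∣_∣ ∘ f) (map suc (upTo n))   ↭⟨ ∣f∣↭ ⟩
    map suc (upTo n)                   ∎
    where open PermutationReasoning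

  peakAt-word : ∀ {f} → f Preserves _<_ ⟶ ℤ._<_ → ∀ k → peakAt (toList (word f)) k ≡ isPeak k
  peakAt-word f-mono zero    = sym peak₀≡false
  peakAt-word {f} f-mono (suc k) = begin
    peakAt (toList (word f)) (suc k)
      ≡⟨ peakAt-tabulate (f ∘ value) {n} k ⟩
    ⌊ suc (suc k) ℕ.<? n ⌋ ∧ ⌊ f (value k) ℤ.<? f (value (suc k)) ⌋
                           ∧ ⌊ f (value (suc (suc k))) ℤ.<? f (value (suc k)) ⌋
      ≡⟨ cong₂ (λ a b → ⌊ suc (suc k) ℕ.<? n ⌋ ∧ a ∧ b) (<?-preserved f-mono _ _)
                                                        (<?-preserved f-mono _ _) ⟩
    ⌊ suc (suc k) ℕ.<? n ⌋ ∧ ⌊ value k ℕ.<? value (suc k) ⌋ ∧ ⌊ value (suc (suc k)) ℕ.<? value (suc k) ⌋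
      ≡⟨ canonical-peak k ⟩
    isPeak (suc k) ∎
    where open ≡-Reasoning

  Peak-word : ∀ {f} → f Preserves _<_ ⟶ ℤ._<_ → (p : IsSignedPerm (word f)) →
    Peak (word f , p) ≡ tabulate (isPeak ∘ toℕ)
  Peak-word f-mono _ = Vecₚ.tabulate-cong (peakAt-word f-mono ∘ toℕ)

  value-zero : value 0 ≡ 1
  value-zero rewrite peak₀≡false = refl

  value-suc≥2 : ∀ p → 2 ≤ value (suc p)
  value-suc≥2 p with isPeak p Boolₚ.≟ true
  ... | no not-peak = ℕₚ.≤-trans (s≤s (s≤s z≤n)) (value-≥ (¬-not not-peak))
  value-suc≥2 zero    | yes peak = contradiction (trans (sym peak) peak₀≡false) λ ()
  value-suc≥2 (suc p) | yes peak = subst (2 ≤_) (sym (value-after-peak peak)) (s≤s (s≤s z≤n))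

-- s₀ and s₁s₀ on positive values; the value at 0 only serves to keep them strictly increasing.
s₀⁺ : ℕ → ℤ
s₀⁺ 0             = -[1+ 1 ]
s₀⁺ 1             = -[1+ 0 ]
s₀⁺ (suc (suc x)) = + suc (suc x)

s₁s₀⁺ : ℕ → ℤ
s₁s₀⁺ 0                   = -[1+ 2 ]
s₁s₀⁺ 1                   = -[1+ 1 ]
s₁s₀⁺ 2                   = + 1
s₁s₀⁺ (suc (suc (suc x))) = + suc (suc (suc x))

s₀⁺-mono : s₀⁺ Preserves _<_ ⟶ ℤ._<_
s₀⁺-mono {0}           {1}           _   = ℤ.-<- (s≤s z≤n)
s₀⁺-mono {0}           {suc (suc _)} _   = ℤ.-<+
s₀⁺-mono {1}           {suc (suc _)} _   = ℤ.-<+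
s₀⁺-mono {suc (suc _)} {suc (suc _)} x<y = ℤ.+<+ x<y
s₀⁺-mono {1}           {1}           (s≤s ())
s₀⁺-mono {suc (suc _)} {1}           (s≤s ())

s₁s₀⁺-mono : s₁s₀⁺ Preserves _<_ ⟶ ℤ._<_
s₁s₀⁺-mono {0}                 {1}                 _   = ℤ.-<- (s≤s (s≤s z≤n))
s₁s₀⁺-mono {0}                 {2}                 _   = ℤ.-<+
s₁s₀⁺-mono {0}                 {suc (suc (suc _))} _   = ℤ.-<+
s₁s₀⁺-mono {1}                 {2}                 _   = ℤ.-<+
s₁s₀⁺-mono {1}                 {suc (suc (suc _))} _   = ℤ.-<+
s₁s₀⁺-mono {2}                 {suc (suc (suc _))} _   = ℤ.+<+ (s≤s (s≤s z≤n))
s₁s₀⁺-mono {suc (suc (suc _))} {suc (suc (suc _))} x<y = ℤ.+<+ x<y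
s₁s₀⁺-mono {1}                 {1}                 (s≤s ())
s₁s₀⁺-mono {2}                 {1}                 (s≤s ())
s₁s₀⁺-mono {2}                 {2}                 (s≤s (s≤s ()))
s₁s₀⁺-mono {suc (suc (suc _))} {1}                 (s≤s ())
s₁s₀⁺-mono {suc (suc (suc _))} {2}                 (s≤s (s≤s ()))

∣s₀⁺-s₁s₀⁺∣≤1 : ∀ x → ∣ s₀⁺ x - s₁s₀⁺ x ∣ ≤ 1
∣s₀⁺-s₁s₀⁺∣≤1 0 = ℕₚ.≤-refl
∣s₀⁺-s₁s₀⁺∣≤1 1 = ℕₚ.≤-refl
∣s₀⁺-s₁s₀⁺∣≤1 2 = ℕₚ.≤-refl
∣s₀⁺-s₁s₀⁺∣≤1 (suc (suc (suc x))) rewrite ℤₚ.+-inverseʳ (+ suc (suc (suc x))) = z≤n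

∣s₀⁺∣-↭ : ∀ n → map (∣_∣ ∘ s₀⁺) (map suc (upTo n)) ↭ map suc (upTo n)
∣s₀⁺∣-↭ n = ↭-reflexive (trans (sym (Listₚ.map-∘ (upTo n))) (Listₚ.map-cong ∣s₀⁺∘suc∣≗suc (upTo n)))
  where
  ∣s₀⁺∘suc∣≗suc : ∀ x → ∣ s₀⁺ (suc x) ∣ ≡ suc x
  ∣s₀⁺∘suc∣≗suc zero    = refl
  ∣s₀⁺∘suc∣≗suc (suc x) = refl

∣s₁s₀⁺∣-↭ : ∀ m → map (∣_∣ ∘ s₁s₀⁺) (map suc (upTo (suc (suc m)))) ↭ map suc (upTo (suc (suc m)))
∣s₁s₀⁺∣-↭ m = swap 2 1 (↭-reflexive (begin
  map (∣_∣ ∘ s₁s₀⁺) (map suc from2)  ≡⟨ Listₚ.map-∘ from2 ⟨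
  map (∣_∣ ∘ s₁s₀⁺ ∘ suc) from2      ≡⟨ Listₚ.map-applyUpTo (suc ∘ suc) (∣_∣ ∘ s₁s₀⁺ ∘ suc) m ⟩
  applyUpTo (suc ∘ suc ∘ suc) m      ≡⟨ Listₚ.map-applyUpTo (suc ∘ suc) suc m ⟨
  map suc from2                      ∎))
  where
  open ≡-Reasoning
  from2 : List ℕ
  from2 = applyUpTo (suc ∘ suc) m

module Witnesses (m : ℕ) (S : Subset (suc (suc m))) (σ : SB (suc (suc m))) (σ∈S : InP S σ) where
  open Canonical (peakPattern (proj₁ σ))

  τ τs₀ s₁s₀τ : SB (suc (suc m))
  τ     = word (+_)  , word-isSignedPerm (+_) (↭-reflexive (Listₚ.map-id _))
  τs₀   = word s₀⁺   , word-isSignedPerm s₀⁺ (∣s₀⁺∣-↭ (suc (suc m)))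
  s₁s₀τ = word s₁s₀⁺ , word-isSignedPerm s₁s₀⁺ (∣s₁s₀⁺∣-↭ m)

  τ∈S : InP S τ
  τ∈S = trans (Peak-word ℤ.+<+ (proj₂ τ)) σ∈S

  τs₀∈S : InP S τs₀
  τs₀∈S = trans (Peak-word s₀⁺-mono (proj₂ τs₀)) σ∈S

  s₁s₀τ∈S : InP S s₁s₀τ
  s₁s₀τ∈S = trans (Peak-word s₁s₀⁺-mono (proj₂ s₁s₀τ)) σ∈S

  τs₀≡negateHead-τ : proj₁ τs₀ ≡ negateHead (proj₁ τ)
  τs₀≡negateHead-τ = cong₂ _∷_
    (trans (cong s₀⁺ value-zero) (cong (-_ ∘ +_) (sym value-zero)))
    (Vecₚ.tabulate-cong λ i → s₀⁺-≥2 (value-suc≥2 (toℕ i)))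
    where
    s₀⁺-≥2 : ∀ {x} → 2 ≤ x → s₀⁺ x ≡ + x
    s₀⁺-≥2 (s≤s (s≤s _)) = refl

  τ≢τs₀ : proj₁ τ ≢ proj₁ τs₀
  τ≢τs₀ τ≡τs₀ = ≢-negateHead τ (trans τ≡τs₀ τs₀≡negateHead-τ)

  τs₀≢s₁s₀τ : proj₁ τs₀ ≢ proj₁ s₁s₀τ
  τs₀≢s₁s₀τ τs₀≡s₁s₀τ =
    subst (λ v → s₀⁺ v ≢ s₁s₀⁺ v) (sym value-zero) (λ ()) (cong Vec.head τs₀≡s₁s₀τ)

  dH-τ-τs₀ : dH τ τs₀ ≡ 1
  dH-τ-τs₀ = dH-negateHead τ τs₀ τs₀≡negateHead-τ

  DW-τ-τs₀ : DW τ τs₀ 1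
  DW-τ-τs₀ = generator⇒DW≡1 τ τs₀ τ≢τs₀ Fin.zero (invB-∘B-negateHead τ τs₀ τs₀≡negateHead-τ)

  dℓ-τs₀-s₁s₀τ : dℓ τs₀ s₁s₀τ ≡ 1
  dℓ-τs₀-s₁s₀τ = ℕₚ.≤-antisym
    (subst (_≤ 1) (sym (dℓ≡chebyshev τs₀ s₁s₀τ)) (chebyshev≤ (proj₁ τs₀) (proj₁ s₁s₀τ) close))
    (≢⇒1≤dℓ τs₀ s₁s₀τ τs₀≢s₁s₀τ)
    where
    close : ∀ i → ∣ lookup (proj₁ τs₀) i - lookup (proj₁ s₁s₀τ) i ∣ ≤ 1
    close i
      rewrite Vecₚ.lookup∘tabulate (s₀⁺ ∘ value ∘ toℕ) i | Vecₚ.lookup∘tabulate (s₁s₀⁺ ∘ value ∘ toℕ) i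
      = ∣s₀⁺-s₁s₀⁺∣≤1 (value (toℕ i))

theorem4p6 : (n : ℕ) → n ≥ 2 → (S : Subset n) → Admissible S →
    -- min d_H = 1
    ((Σ (SB n) λ σ → Σ (SB n) λ ρ →
        InP S σ × InP S ρ × proj₁ σ ≢ proj₁ ρ × dH σ ρ ≡ 1)
      × (∀ (σ ρ : SB n) → InP S σ → InP S ρ → proj₁ σ ≢ proj₁ ρ → 1 ≤ dH σ ρ))
    -- min d_ℓ = 1
    × ((Σ (SB n) λ σ → Σ (SB n) λ ρ →
        InP S σ × InP S ρ × proj₁ σ ≢ proj₁ ρ × dℓ σ ρ ≡ 1)
      × (∀ (σ ρ : SB n) → InP S σ → InP S ρ → proj₁ σ ≢ proj₁ ρ → 1 ≤ dℓ σ ρ))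
    -- min d_W = 1
    × ((Σ (SB n) λ σ → Σ (SB n) λ ρ →
        InP S σ × InP S ρ × proj₁ σ ≢ proj₁ ρ × DW σ ρ 1)
      × (∀ (σ ρ : SB n) → InP S σ → InP S ρ → proj₁ σ ≢ proj₁ ρ →
          ∀ k → DW σ ρ k → 1 ≤ k))
theorem4p6 (suc zero) (s≤s ())
theorem4p6 (suc (suc m)) _ S (σ , σ∈S) =
  ((τ , τs₀ , τ∈S , τs₀∈S , τ≢τs₀ , dH-τ-τs₀) , λ π ρ _ _ → ≢⇒1≤dH π ρ) ,
  ((τs₀ , s₁s₀τ , τs₀∈S , s₁s₀τ∈S , τs₀≢s₁s₀τ , dℓ-τs₀-s₁s₀τ) , λ π ρ _ _ → ≢⇒1≤dℓ π ρ) ,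
  ((τ , τs₀ , τ∈S , τs₀∈S , τ≢τs₀ , DW-τ-τs₀) , λ π ρ _ _ → ≢⇒1≤DW π ρ)
  where open Witnesses m S σ σ∈S
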